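{- Suppose that for every ordered pair $(x,y)$ of vertices the tree $T(x,y)$ stores exactly the intervals $[t^-,t^+]$ of the minimal R-tuples $(x,y,t^-,t^+)$ of $\mathcal{G}$ (together with a valid successor). If Algorithm 2 on query $(u,v,t_1,t_2)$ returns a journey $\mathcal{J}$, then $\mathcal{J}$ is a foremost journey from $u$ to $v$ within $[t_1,t_2]$ (i.e. its arrival time is the earliest among all journeys from $u$ to $v$ with departure $\ge t_1$ and arrival $\le t_2$), and among all such foremost journeys it is a fastest one (its arrival minus departure is minimal).
   Context: A temporal graph $\mathcal{G}$ has vertex set $V$ ($|V|=n$), arcs $E\subseteq V\times V$, lifetime $[1,\tau]\subseteq\mathbb{N}$, presence function $\rho:E\times[1,\tau]\to\{0,1\}$ and constant latency $\delta\in\mathbb{N}$; a contact is $(x,y,t)$ with $\rho((x,y),t)=1$. A journey from $u$ to $v$ is a sequence of contacts $\langle(u_1,v_1,t_1),\dots,(u_k,v_k,t_k)\rangle$ forming a directed $u$–$v$ path with $t_{i+1}\ge t_i+\delta$; departure $t_1$, arrival $t_k+\delta$. An R-tuple $(x,y,t^-,t^+)$ records that some journey from $x$ to $y$ has departure $t^-$ and arrival $t^+$; it is minimal if there is no other R-tuple $(x,y,s^-,s^+)$ with $t^-\le s^-\le s^+\le t^+$. Each stored interval carries a successor vertex $w$ such that some journey represented by it starts with the contact $(x,w,t^-)$. $\textsc{find\_next}(x,y,s)$ returns the stored interval of $T(x,y)$ with the earliest departure $\ge s$ together with its successor (or nil). Algorithm 2: let $([t^-,t^+],w)=\textsc{find\_next}(u,v,t_1)$;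 if nil or $t^+>t_2$ return nil; otherwise set $\mathcal{J}\gets\langle(u,w,t^-)\rangle$ and, while $w\ne v$: let $([s,\cdot],w')=\textsc{find\_next}(w,v,t^-+\delta)$, append $(w,w',s)$, set $w\gets w'$, $t^-\gets s$; return $\mathcal{J}$. -}

module Defs where

open import Data.Nat using (ℕ; zero; suc; _+_; _∸_; _≤_; _<_; _≤?_; _<?_)
open import Data.Fin using (Fin; _≟_)
open import Data.Bool using (Bool; true; false)
open import Data.Maybe using (Maybe; just; nothing)
open import Data.List using (List; []; _∷_)
open import Data.List.Membership.Propositional using (_∈_)
open import Data.Product using (Σ; ∃; _×_; _,_)
open import Relation.Nullary using (yes; no)
open import Relation.Binary.PropositionalEquality using (_≡_)
open import Function.Bundles using (_⇔_)

-- A temporal graph with vertex set Fin n, arc set given by the decidable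
-- predicate arc, lifetime [1, τ], presence function ρ and latency δ.
record TemporalGraph : Set where
  field
    n   : ℕ
    arc : Fin n → Fin n → Bool
    τ   : ℕ
    ρ   : Fin n → Fin n → ℕ → Bool
    δ   : ℕ

module _ (G : TemporalGraph) where
  open TemporalGraph G

  Vertex : Set
  Vertex = Fin n

  Contact : Set
  Contact = Vertex × Vertex × ℕ

  IsContact : Vertex → Vertex → ℕ → Set
  IsContact x y t = (arc x y ≡ true) × (ρ x y t ≡ true) × (1 ≤ t) × (t ≤ τ)

  data IsJourney : Vertex → Vertex → ℕ → List Contact → Set where
    one  : ∀ {x y t} → IsContact x y t → IsJourney x y t ((x , y , t) ∷ [])
    more : ∀ {x w y t s cs} → IsContact x w t → t + δ ≤ s →
           IsJourney w y s cs → IsJourney x y t ((x , w , t) ∷ cs)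

  arrival : List Contact → ℕ
  arrival [] = 0
  arrival ((_ , _ , t) ∷ []) = t + δ
  arrival (_ ∷ c ∷ cs) = arrival (c ∷ cs)

  RTuple : Vertex → Vertex → ℕ → ℕ → Set
  RTuple x y a b = Σ (List Contact) λ J → IsJourney x y a J × (arrival J ≡ b)

  MinimalRTuple : Vertex → Vertex → ℕ → ℕ → Set
  MinimalRTuple x y a b =
    RTuple x y a b ×
    (∀ s⁻ s⁺ → RTuple x y s⁻ s⁺ → a ≤ s⁻ → s⁻ ≤ s⁺ → s⁺ ≤ b →
       (s⁻ ≡ a) × (s⁺ ≡ b))

  -- a stored entry: interval [t⁻ , t⁺] and successor w
  Entry : Set
  Entry = ℕ × ℕ × Vertex

  Store : Set
  Store = Vertex → Vertex → List Entry

  StoresExactlyMinimal : Store → Set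
  StoresExactlyMinimal T =
    ∀ x y a b → MinimalRTuple x y a b ⇔ (∃ λ w → (a , b , w) ∈ T x y)

  ValidSuccessors : Store → Set
  ValidSuccessors T =
    ∀ x y a b w → (a , b , w) ∈ T x y →
      Σ (List Contact) λ J →
        IsJourney x y a ((x , w , a) ∷ J) × (arrival ((x , w , a) ∷ J) ≡ b)

  -- find_next on a list: entry with earliest departure ≥ s (first one on ties)
  findNextL : ℕ → List Entry → Maybe Entry
  findNextL s [] = nothing
  findNextL s ((a , b , w) ∷ es) with s ≤? a | findNextL s es
  ... | no _  | r = r
  ... | yes _ | nothing = just (a , b , w)
  ... | yes _ | just (a' , b' , w') with a ≤? a'
  ...   | yes _ = just (a , b , w)
  ...   | no _  = just (a' , b' , w')

  findNext : Store → Vertex → Vertex → ℕ → Maybe Entry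
  findNext T x y s = findNextL s (T x y)

  -- the while-loop of Algorithm 2, run with a fuel bound (the loop's
  -- termination is not assumed; "returns J" = returns J for some fuel)
  algLoop : Store → Vertex → ℕ → Vertex → ℕ → Maybe (List Contact)
  algLoop T v fuel w t with w ≟ v
  ... | yes _ = just []
  algLoop T v zero w t | no _ = nothing
  algLoop T v (suc f) w t | no _ with findNext T w v (t + δ)
  ... | nothing = nothing
  ... | just (s , _ , w') with algLoop T v f w' s
  ...   | nothing = nothing
  ...   | just cs = just ((w , w' , s) ∷ cs)

  algorithm2 : Store → ℕ → Vertex → Vertex → ℕ → ℕ → Maybe (List Contact)
  algorithm2 T fuel u v t₁ t₂ with findNext T u v t₁
  ... | nothing = nothing
  ... | just (t⁻ , t⁺ , w) with t₂ <? t⁺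
  ...   | yes _ = nothing
  ...   | no _ with algLoop T v fuel w t⁻
  ...     | nothing = nothing
  ...     | just cs = just ((u , w , t⁻) ∷ cs)

  Algorithm2Returns : Store → Vertex → Vertex → ℕ → ℕ → List Contact → Set
  Algorithm2Returns T u v t₁ t₂ J = ∃ λ fuel → algorithm2 T fuel u v t₁ t₂ ≡ just J

  JourneyWithin : Vertex → Vertex → ℕ → ℕ → ℕ → List Contact → Set
  JourneyWithin u v t₁ t₂ d J = IsJourney u v d J × (t₁ ≤ d) × (arrival J ≤ t₂)

  ForemostFastest : Vertex → Vertex → ℕ → ℕ → List Contact → Set
  ForemostFastest u v t₁ t₂ J =
    Σ ℕ λ d → JourneyWithin u v t₁ t₂ d J ×
      (∀ d' J' → JourneyWithin u v t₁ t₂ d' J' → arrival J ≤ arrival J') ×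
      (∀ d' J' → JourneyWithin u v t₁ t₂ d' J' → arrival J' ≡ arrival J →
         arrival J ∸ d ≤ arrival J' ∸ d')

-- Every R-tuple contains a minimal one, all minimal intervals are stored, and minimal
-- intervals cannot be nested, so among them arrival grows with departure.  Hence the earliest
-- stored interval [t⁻ , t⁺] departing at or after t₁ arrives no later than any journey
-- departing at or after t₁ (foremost), and no journey departing after t⁻ arrives by t⁺
-- (fastest).  The same argument shows that in each iteration of the loop the chosen successor
-- interval arrives no later than the journey witnessing the previous one, so the constructed
-- journey arrives by t⁺, hence exactly at t⁺ by minimality of [t⁻ , t⁺].
module Submission where

open import Defs
open import Data.Nat using (ℕ; suc; s≤s; _+_; _∸_; _≤_; _<_; _≤?_; _<?_)
open import Data.Nat.Properties
  using (≤-refl; ≤-trans; ≤-reflexive; <⇒≤; ≰⇒>; ≮⇒≥; ≤∧≢⇒<; m≤m+n; +-monoˡ-≤;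
         ∸-monoˡ-≤; ∸-monoʳ-≤; ∸-monoˡ-<; ∸-monoʳ-<)
import Data.Nat.Properties as ℕ
open import Data.Nat.Induction using (<-wellFounded)
open import Data.Fin using (_≟_)
open import Data.Maybe using (just; nothing)
open import Data.List using (List; _∷_)
open import Data.List.Membership.Propositional using (_∈_)
open import Data.List.Relation.Unary.Any using (here; there)
open import Data.Product using (∃; ∃₂; _×_; _,_; proj₁; proj₂)
open import Data.Sum using (_⊎_; inj₁; inj₂)
open import Data.Empty using (⊥-elim)
open import Function.Bundles using (Equivalence)
open import Induction.WellFounded using (Acc; acc)
open import Relation.Nullary using (¬_; yes; no)
open import Relation.Nullary.Decidable using (decidable-stable)
open import Relation.Binary.PropositionalEquality using (_≡_; refl; sym; trans; subst; ≢-sym)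

width-shrinks : ∀ {a b s t} → a ≤ s → s ≤ t → t ≤ b → a < s ⊎ t < b → t ∸ s < b ∸ a
width-shrinks {s = s} a≤s s≤t t≤b (inj₁ a<s) = ≤-trans (s≤s (∸-monoˡ-≤ s t≤b)) (∸-monoʳ-< a<s (≤-trans s≤t t≤b))
width-shrinks a≤s s≤t t≤b (inj₂ t<b) = ≤-trans (∸-monoˡ-< t<b s≤t) (∸-monoʳ-≤ _ a≤s)

same-or-proper : ∀ {a b s t} → a ≤ s → t ≤ b → (s ≡ a × t ≡ b) ⊎ (a < s ⊎ t < b)
same-or-proper {a} {b} {s} {t} a≤s t≤b with s ℕ.≟ a | t ℕ.≟ b
... | yes s≡a | yes t≡b = inj₁ (s≡a , t≡b)
... | no s≢a | _ = inj₂ (inj₁ (≤∧≢⇒< a≤s (≢-sym s≢a)))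
... | yes _ | no t≢b = inj₂ (inj₂ (≤∧≢⇒< t≤b t≢b))

module _ (G : TemporalGraph) where
  open TemporalGraph G

  Earliest : ℕ → List (Entry G) → Entry G → Set
  Earliest s es (a , b , w) =
    (a , b , w) ∈ es × s ≤ a × (∀ {a′ b′ w′} → (a′ , b′ , w′) ∈ es → s ≤ a′ → a ≤ a′)

  findNextL-nothing : ∀ {s es a b w} → findNextL G s es ≡ nothing → (a , b , w) ∈ es → ¬ s ≤ a
  findNextL-nothing {s} {(a₀ , _ , _) ∷ es} eq e∈ with s ≤? a₀ | findNextL G s es in rest
  findNextL-nothing eq (here refl) | no s≰a₀ | _ = s≰a₀
  findNextL-nothing eq (there e∈) | no _ | _ = findNextL-nothing (trans rest eq) e∈
  ... | yes _ | just (a₁ , _ , _) with a₀ ≤? a₁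
  findNextL-nothing () e∈ | yes _ | just _ | yes _
  findNextL-nothing () e∈ | yes _ | just _ | no _

  findNextL-just : ∀ {s es e} → findNextL G s es ≡ just e → Earliest s es e
  findNextL-just {s} {(a₀ , _ , _) ∷ es} eq with s ≤? a₀ | findNextL G s es in rest
  ... | no s≰a₀ | _ =
    let e∈ , s≤a , least = findNextL-just (trans rest eq) in
    there e∈ , s≤a , λ { (here refl) s≤a₀ → ⊥-elim (s≰a₀ s≤a₀) ; (there e′∈) → least e′∈ }
  findNextL-just refl | yes s≤a₀ | nothing =
    here refl , s≤a₀ , λ { (here refl) _ → ≤-refl ; (there e′∈) s≤a′ → ⊥-elim (findNextL-nothing rest e′∈ s≤a′) }
  ... | yes s≤a₀ | just (a₁ , _ , _) with a₀ ≤? a₁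
  ...   | yes a₀≤a₁ with refl ← eq =
    let _ , _ , least = findNextL-just rest in
    here refl , s≤a₀ , λ { (here refl) _ → ≤-refl ; (there e′∈) s≤a′ → ≤-trans a₀≤a₁ (least e′∈ s≤a′) }
  ...   | no a₀≰a₁ with refl ← eq =
    let e∈ , s≤a₁ , least = findNextL-just rest in
    there e∈ , s≤a₁ , λ { (here refl) _ → <⇒≤ (≰⇒> a₀≰a₁) ; (there e′∈) → least e′∈ }

  arrival-∷ : ∀ c {x y d J} → IsJourney G x y d J → arrival G (c ∷ J) ≡ arrival G J
  arrival-∷ c (one _) = refl
  arrival-∷ c (more _ _ _) = refl

  departure+δ≤arrival : ∀ {x y d J} → IsJourney G x y d J → d + δ ≤ arrival G J
  departure+δ≤arrival (one _) = ≤-refl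
  departure+δ≤arrival {J = c ∷ _} (more _ t+δ≤s j) = begin
    _ ≤⟨ +-monoˡ-≤ δ (≤-trans (m≤m+n _ δ) t+δ≤s) ⟩
    _ ≤⟨ departure+δ≤arrival j ⟩
    _ ≡⟨ sym (arrival-∷ c j) ⟩
    _ ∎
    where open ℕ.≤-Reasoning

  departure≤arrival : ∀ {x y d J} → IsJourney G x y d J → d ≤ arrival G J
  departure≤arrival j = ≤-trans (m≤m+n _ δ) (departure+δ≤arrival j)

  first-contact : ∀ {x y w t d J} → IsJourney G x y d ((x , w , t) ∷ J) → IsContact G x w t
  first-contact (one c) = c
  first-contact (more c _ _) = c

  RTuple⇒≤ : ∀ {x y a b} → RTuple G x y a b → a ≤ b
  RTuple⇒≤ (_ , j , refl) = departure≤arrival j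

  MinimalWithin : Vertex G → Vertex G → ℕ → ℕ → Set
  MinimalWithin x y a b = ∃₂ λ a′ b′ → MinimalRTuple G x y a′ b′ × a ≤ a′ × b′ ≤ b

  -- Double negation because whether an interval is minimal is not decidable: candidate
  -- journeys are unbounded in length.  All consequences drawn below are decidable.
  RTuple⇒¬¬MinimalWithin : ∀ {x y a b} → RTuple G x y a b → ¬ ¬ MinimalWithin x y a b
  RTuple⇒¬¬MinimalWithin {a = a} {b} = go (<-wellFounded (b ∸ a))
    where
    go : ∀ {x y a b} → Acc _<_ (b ∸ a) → RTuple G x y a b → ¬ ¬ MinimalWithin x y a b
    go {x} {y} {a} {b} (acc narrower) r none = none (a , b , (r , minimal) , ≤-refl , ≤-refl)
      where
      minimal : ∀ s t → RTuple G x y s t → a ≤ s → s ≤ t → t ≤ b → (s ≡ a) × (t ≡ b)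
      minimal s t r′ a≤s s≤t t≤b with same-or-proper a≤s t≤b
      ... | inj₁ same = same
      ... | inj₂ proper = ⊥-elim (go (narrower (width-shrinks a≤s s≤t t≤b proper)) r′
              λ { (a′ , b′ , m , s≤a′ , b′≤t) → none (a′ , b′ , m , ≤-trans a≤s s≤a′ , ≤-trans b′≤t t≤b) })

  minimal-arrival-mono : ∀ {x y a b a′ b′} → MinimalRTuple G x y a b → MinimalRTuple G x y a′ b′ →
    a ≤ a′ → b ≤ b′
  minimal-arrival-mono {b = b} {a′} {b′} (_ , minimal) (r′ , _) a≤a′ with b ≤? b′
  ... | yes b≤b′ = b≤b′
  ... | no b≰b′ = ⊥-elim (b≰b′ (≤-reflexive (sym b′≡b)))
    where b′≡b = proj₂ (minimal a′ b′ r′ a≤a′ (RTuple⇒≤ r′) (<⇒≤ (≰⇒> b≰b′)))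

  RTupleVia : Vertex G → Vertex G → Vertex G → ℕ → ℕ → Set
  RTupleVia x w y a b =
    ∃ λ J → IsJourney G x y a ((x , w , a) ∷ J) × arrival G ((x , w , a) ∷ J) ≡ b

  module _ (T : Store G) (exact : StoresExactlyMinimal G T) where

    stored⇒minimal : ∀ {x y a b w} → (a , b , w) ∈ T x y → MinimalRTuple G x y a b
    stored⇒minimal e∈ = Equivalence.from (exact _ _ _ _) (_ , e∈)

    minimal⇒stored : ∀ {x y a b} → MinimalRTuple G x y a b → ∃ λ w → (a , b , w) ∈ T x y
    minimal⇒stored = Equivalence.to (exact _ _ _ _)

    earliest-arrives-first : ∀ {s x y a b w a′ b′} → Earliest s (T x y) (a , b , w) →
      RTuple G x y a′ b′ → s ≤ a′ → b ≤ b′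
    earliest-arrives-first {b = b} {b′ = b′} (e∈ , _ , least) r s≤a′ =
      decidable-stable (b ≤? b′) λ b≰b′ → RTuple⇒¬¬MinimalWithin r
        λ { (a″ , b″ , m , a′≤a″ , b″≤b′) →
              let a≤a″ = least (proj₂ (minimal⇒stored m)) (≤-trans s≤a′ a′≤a″)
              in b≰b′ (≤-trans (minimal-arrival-mono (stored⇒minimal e∈) m a≤a″) b″≤b′) }

    earliest-departs-last : ∀ {s x y a b w a′ b′} → Earliest s (T x y) (a , b , w) →
      RTuple G x y a′ b′ → s ≤ a′ → b′ ≤ b → a′ ≤ a
    earliest-departs-last {a = a} {a′ = a′} (e∈ , _ , least) r s≤a′ b′≤b =
      decidable-stable (a′ ≤? a) λ a′≰a → RTuple⇒¬¬MinimalWithin r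
        λ { (a″ , b″ , m@(r″ , _) , a′≤a″ , b″≤b′) →
              let a≤a″ = least (proj₂ (minimal⇒stored m)) (≤-trans s≤a′ a′≤a″)
                  a″≡a = proj₁ (proj₂ (stored⇒minimal e∈) a″ b″ r″ a≤a″ (RTuple⇒≤ r″) (≤-trans b″≤b′ b′≤b))
              in a′≰a (≤-trans a′≤a″ (≤-reflexive a″≡a)) }

    module _ (valid : ValidSuccessors G T) where

      algLoop-sound : ∀ {v fuel x w t cs B} → algLoop G T v fuel w t ≡ just cs → RTupleVia x w v t B →
        IsJourney G x v t ((x , w , t) ∷ cs) × arrival G ((x , w , t) ∷ cs) ≤ B
      algLoop-sound {v} {fuel} {w = w} {t} eq via with w ≟ v
      algLoop-sound refl (_ , j , refl) | yes refl = one (first-contact j) , departure+δ≤arrival j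
      algLoop-sound {v} {suc fuel} {w = w} {t} eq via | no w≢v with findNext G T w v (t + δ) in found
      algLoop-sound {v} {suc fuel} eq via | no w≢v | just (s , b , w′) with algLoop G T v fuel w′ s in rest
      algLoop-sound refl (_ , one _ , _) | no w≢v | just _ | just _ = ⊥-elim (w≢v refl)
      algLoop-sound {v} {suc fuel} {w = w} {t} {B = B} refl (J , more c t+δ≤s₀ j , refl)
        | no _ | just (s , b , w′) | just cs′ = more c t+δ≤s (proj₁ tail) , arrival≤B
        where
        earliest : Earliest (t + δ) (T w v) (s , b , w′)
        earliest = findNextL-just found
        t+δ≤s : t + δ ≤ s
        t+δ≤s = proj₁ (proj₂ earliest)
        tail : IsJourney G w v s ((w , w′ , s) ∷ cs′) × arrival G ((w , w′ , s) ∷ cs′) ≤ b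
        tail = algLoop-sound rest (valid _ _ _ _ _ (proj₁ earliest))
        arrival≤B : arrival G ((w , w′ , s) ∷ cs′) ≤ B
        arrival≤B = ≤-trans (proj₂ tail)
          (earliest-arrives-first earliest (J , j , sym (arrival-∷ _ j)) t+δ≤s₀)

      earliest-answers-query : ∀ {u v t₁ t₂ t⁻ t⁺ w fuel cs} → Earliest t₁ (T u v) (t⁻ , t⁺ , w) →
        t⁺ ≤ t₂ → algLoop G T v fuel w t⁻ ≡ just cs → ForemostFastest G u v t₁ t₂ ((u , w , t⁻) ∷ cs)
      earliest-answers-query {u} {v} {t₁} {t₂} {t⁻} {t⁺} {w} {cs = cs} earliest@(e∈ , t₁≤t⁻ , _) t⁺≤t₂ loop =
        t⁻ , (journey , t₁≤t⁻ , subst (_≤ t₂) (sym arrives-at-t⁺) t⁺≤t₂) , foremost , fastest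
        where
        J = (u , w , t⁻) ∷ cs
        built : IsJourney G u v t⁻ J × arrival G J ≤ t⁺
        built = algLoop-sound loop (valid _ _ _ _ _ e∈)
        journey : IsJourney G u v t⁻ J
        journey = proj₁ built
        arrives-at-t⁺ : arrival G J ≡ t⁺
        arrives-at-t⁺ = proj₂ (proj₂ (stored⇒minimal e∈) t⁻ _ (J , journey , refl) ≤-refl
          (departure≤arrival journey) (proj₂ built))
        foremost : ∀ d′ J′ → JourneyWithin G u v t₁ t₂ d′ J′ → arrival G J ≤ arrival G J′
        foremost _ J′ (j′ , t₁≤d′ , _) =
          subst (_≤ arrival G J′) (sym arrives-at-t⁺) (earliest-arrives-first earliest (J′ , j′ , refl) t₁≤d′)
        fastest : ∀ d′ J′ → JourneyWithin G u v t₁ t₂ d′ J′ → arrival G J′ ≡ arrival G J →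
          arrival G J ∸ t⁻ ≤ arrival G J′ ∸ d′
        fastest d′ J′ (j′ , t₁≤d′ , _) same-arrival = subst (λ b → arrival G J ∸ t⁻ ≤ b ∸ d′) (sym same-arrival)
          (∸-monoʳ-≤ _ (earliest-departs-last earliest (J′ , j′ , trans same-arrival arrives-at-t⁺) t₁≤d′ ≤-refl))

lemma4 : (G : TemporalGraph) (T : Store G) →
    StoresExactlyMinimal G T → ValidSuccessors G T →
    (u v : Vertex G) (t₁ t₂ : ℕ) (J : List (Contact G)) →
    Algorithm2Returns G T u v t₁ t₂ J →
    ForemostFastest G u v t₁ t₂ J
lemma4 G T exact valid u v t₁ t₂ J (fuel , returns) with findNext G T u v t₁ in found
... | just (t⁻ , t⁺ , w) with t₂ <? t⁺
... | no t₂≮t⁺ with algLoop G T v fuel w t⁻ in loop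
... | just cs with refl ← returns =
  earliest-answers-query G T exact valid (findNextL-just G found) (≮⇒≥ t₂≮t⁺) loop
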